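{- Let $c\ge 1$ and $r$ be positive integers with $r>2c$, and let $n> c+c\binom{r}{2}$. Then $R^c(B^rK_n)=n$.
   Context: An $r$-uniform hypergraph ($r$-graph) consists of a vertex set and a set of $r$-element subsets of it (hyperedges); $\mathcal{K}_N^r$ denotes the complete $r$-graph on $N$ vertices and $K_n$ the complete graph on $n$ vertices. For a graph $F$, an $r$-graph $\mathcal{H}$ contains a Berge copy of $F$ (a Berge-$F$) if there are an injection $\varphi:V(F)\to V(\mathcal{H})$ and an injection $f$ from $E(F)$ to the hyperedges of $\mathcal{H}$ with $\{\varphi(x),\varphi(y)\}\subseteq f(xy)$ for every edge $xy\in E(F)$; $B^rF$ denotes the family of $r$-uniform Berge copies of $F$. A $c$-coloring of an $r$-graph assigns to each hyperedge one of the colors $1,\dots,c$ (not every color need be used). For graphs $G_1,\dots,G_c$, $R(B^rG_1,\dots,B^rG_c)$ is the smallest $N$ such that in every $c$-coloring of $\mathcal{K}_N^r$ there is an $i\le c$ for which the hyperedges of color $i$ contain a Berge-$G_i$. $R^c(B^rG)$ denotes $R(B^rG,\dots,B^rG)$ with $c$ entries. -}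

module Defs where

open import Data.Nat using (ℕ; _<_)
open import Data.Fin as Fin using (Fin)
open import Data.Fin.Subset using (Subset; _∈_; ∣_∣)
open import Data.Product using (Σ; _×_; _,_; proj₁; ∃)
open import Relation.Binary.PropositionalEquality using (_≡_)
open import Relation.Nullary using (¬_)
open import Function.Definitions using (Injective)

-- Vertex set of K_N^r is Fin N; its hyperedges are the subsets of Fin N of size r.
-- A c-coloring of K_N^r: a map assigning a color in Fin c to every subset of
-- Fin N (only its values on r-element subsets, i.e. hyperedges, matter).
Coloring : ℕ → ℕ → Set
Coloring c N = Subset N → Fin c

EdgeK : ℕ → Set
EdgeK n = Σ (Fin n × Fin n) (λ p → proj₁ p Fin.< Data.Product.proj₂ p)

HasBergeK : (r n : ℕ) {c N : ℕ} → Coloring c N → Fin c → Set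
HasBergeK r n {c} {N} χ i =
  Σ (Fin n → Fin N) λ φ →
  Σ (EdgeK n → Subset N) λ f →
    Injective _≡_ _≡_ φ
    × Injective (λ e e′ → proj₁ e ≡ proj₁ e′) _≡_ f
    × ((e : EdgeK n) →
         ∣ f e ∣ ≡ r
       × χ (f e) ≡ i
       × φ (proj₁ (proj₁ e)) ∈ f e
       × φ (Data.Product.proj₂ (proj₁ e)) ∈ f e)

Arrows : (c r n N : ℕ) → Set
Arrows c r n N = (χ : Coloring c N) → ∃ λ (i : Fin c) → HasBergeK r n χ i

RamseyBergeK≡ : (c r n R : ℕ) → Set
RamseyBergeK≡ c r n R = Arrows c r n R × ((N : ℕ) → N < R → ¬ Arrows c r n N)

-- For a colour j, let pairs x < y of vertices be adjacent to the r-sets of colour j that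
-- contain them. An r-set contains exactly C(r,2) pairs, so if every pair lies in at least
-- C(r,2) r-sets of colour j, Hall's condition follows by double counting, and a matching of
-- the pairs into distinct r-sets is a Berge-K_n of colour j. Otherwise every colour j has a
-- pair p_j lying in fewer than C(r,2) r-sets of colour j. Their endpoints form a set U with
-- |U| ≤ 2c < r, and each of the at least C(n-|U|, r-|U|) ≥ n-|U| r-sets containing U is
-- counted at p_j for its own colour j; hence n - 2c ≤ c (C(r,2) - 1), contradicting
-- n > c + c C(r,2). On fewer than n vertices there is no injective image of K_n at all.

module Submission where

open import Defs
open import Data.Nat
  using (ℕ; zero; suc; NonZero; >-nonZero; _<_; _≤_; _<?_; _≤?_; _≟_; s≤s⁻¹; _+_; _*_; _∸_; _^_; z≤n; s≤s)
open import Data.Nat.Properties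
open import Data.Nat.Combinatorics using (_C_; nC1≡n; nCk+nC[k+1]≡[n+1]C[k+1])
open import Data.Bool using (if_then_else_)
open import Data.Fin as Fin using (Fin; zero; suc; _↑ˡ_; _↑ʳ_; combine; remQuot)
open import Data.Fin.Properties
  using (injective⇒≤; any?; all?; ¬∀⟶∃¬; combine-injective; remQuot-combine; combine-remQuot)
open import Data.Fin.Subset
open import Data.Fin.Subset.Properties
open import Data.Product using (∃; _×_; _,_; proj₁; proj₂; map; map₁)
open import Data.Sum using (_⊎_; inj₁; inj₂)
open import Data.Vec using ([]; _∷_; tabulate; here; there)
open import Data.Vec.Properties using (∷-injective)
open import Function using (_∘_)
open import Relation.Binary.PropositionalEquality
open import Relation.Nullary
open import Relation.Unary using (Decidable)
open import Relation.Nullary.Decidable using (_×-dec_; _→-dec_; ¬?)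
open import Algebra.Properties.Semiring.Sum +-*-semiring
  using (sum; sum-syntax; sum-cong-≗; sum-replicate-zero; ∑-distrib-+; ∑-comm; *-distribˡ-sum)

𝟙 : ∀ {p} {P : Set p} → Dec P → ℕ
𝟙 P? = if does P? then 1 else 0

𝟙-yes : ∀ {p} {P : Set p} (P? : Dec P) → P → 𝟙 P? ≡ 1
𝟙-yes (yes _) _ = refl
𝟙-yes (no ¬p) p = contradiction p ¬p

𝟙-no : ∀ {p} {P : Set p} (P? : Dec P) → ¬ P → 𝟙 P? ≡ 0
𝟙-no (yes p) ¬p = contradiction p ¬p
𝟙-no (no _) _ = refl

𝟙-mono : ∀ {p q} {P : Set p} {Q : Set q} → (P → Q) → (P? : Dec P) (Q? : Dec Q) → 𝟙 P? ≤ 𝟙 Q?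
𝟙-mono P→Q (yes p) Q? = ≤-reflexive (sym (𝟙-yes Q? (P→Q p)))
𝟙-mono P→Q (no _) Q? = z≤n

sum-mono-≤ : ∀ {n} {f g : Fin n → ℕ} → (∀ i → f i ≤ g i) → sum f ≤ sum g
sum-mono-≤ {zero} f≤g = z≤n
sum-mono-≤ {suc n} f≤g = +-mono-≤ (f≤g zero) (sum-mono-≤ (f≤g ∘ suc))

≤-sum : ∀ {n} (f : Fin n → ℕ) i → f i ≤ sum f
≤-sum f zero = m≤m+n _ _
≤-sum f (suc i) = ≤-trans (≤-sum (f ∘ suc) i) (m≤n+m _ _)

∑-const : ∀ n k → ∑[ i < n ] k ≡ n * k
∑-const zero k = refl
∑-const (suc n) k = cong (k +_) (∑-const n k)

∑-suc : ∀ {n} (f : Fin n → ℕ) → ∑[ i < n ] suc (f i) ≡ n + sum f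
∑-suc {n} f = trans (∑-distrib-+ (λ _ → 1) f) (cong (_+ sum f) (trans (∑-const n 1) (*-identityʳ n)))

∑-↑ : ∀ m {n} (f : Fin (m + n) → ℕ) → sum f ≡ ∑[ i < m ] f (i ↑ˡ n) + ∑[ j < n ] f (m ↑ʳ j)
∑-↑ zero f = refl
∑-↑ (suc m) f = trans (cong (f zero +_) (∑-↑ m (f ∘ suc))) (sym (+-assoc (f zero) _ _))

∑-combine : ∀ m {n} (f : Fin (m * n) → ℕ) → sum f ≡ ∑[ i < m ] ∑[ j < n ] f (combine i j)
∑-combine zero f = refl
∑-combine (suc m) {n} f = trans (∑-↑ n f) (cong (∑[ j < n ] f (j ↑ˡ m * n) +_) (∑-combine m (f ∘ (n ↑ʳ_))))

∑-remQuot : ∀ m {n} (g : Fin m × Fin n → ℕ) → ∑[ p < m * n ] g (remQuot n p) ≡ ∑[ x < m ] ∑[ y < n ] g (x , y)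
∑-remQuot m {n} g = trans (∑-combine m (g ∘ remQuot n))
  (sum-cong-≗ λ x → sum-cong-≗ λ y → cong g (remQuot-combine x y))

toSubset : ∀ {n p} {P : Fin n → Set p} → Decidable P → Subset n
toSubset P? = tabulate (does ∘ P?)

∈-toSubset⁺ : ∀ {n p} {P : Fin n → Set p} (P? : Decidable P) {x} → P x → x ∈ toSubset P?
∈-toSubset⁺ {suc n} P? {zero} px with P? zero
... | yes _ = here
... | no ¬px = contradiction px ¬px
∈-toSubset⁺ {suc n} P? {suc x} px = there (∈-toSubset⁺ (P? ∘ suc) px)

∈-toSubset⁻ : ∀ {n p} {P : Fin n → Set p} (P? : Decidable P) {x} → x ∈ toSubset P? → P x
∈-toSubset⁻ {suc n} P? {zero} x∈ with P? zero | x∈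
... | yes px | _ = px
∈-toSubset⁻ {suc n} P? {suc x} (there x∈) = ∈-toSubset⁻ (P? ∘ suc) x∈

∣toSubset∣ : ∀ {n p} {P : Fin n → Set p} (P? : Decidable P) → ∣ toSubset P? ∣ ≡ ∑[ i < n ] 𝟙 (P? i)
∣toSubset∣ {zero} P? = refl
∣toSubset∣ {suc n} P? with P? zero
... | yes _ = cong suc (∣toSubset∣ (P? ∘ suc))
... | no _ = ∣toSubset∣ (P? ∘ suc)

∣p∣≡∑𝟙 : ∀ {n} (p : Subset n) → ∣ p ∣ ≡ ∑[ i < n ] 𝟙 (i ∈? p)
∣p∣≡∑𝟙 [] = refl
∣p∣≡∑𝟙 (inside ∷ p) = cong suc (∣p∣≡∑𝟙 p)
∣p∣≡∑𝟙 (outside ∷ p) = ∣p∣≡∑𝟙 p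

∣p∪q∣≤∣p∣+∣q∣ : ∀ {n} (p q : Subset n) → ∣ p ∪ q ∣ ≤ ∣ p ∣ + ∣ q ∣
∣p∪q∣≤∣p∣+∣q∣ [] [] = z≤n
∣p∪q∣≤∣p∣+∣q∣ (inside ∷ p) (s ∷ q) = s≤s (≤-trans (∣p∪q∣≤∣p∣+∣q∣ p q) (+-monoʳ-≤ ∣ p ∣ (∣p∣≤∣x∷p∣ s q)))
∣p∪q∣≤∣p∣+∣q∣ (outside ∷ p) (inside ∷ q) = ≤-trans (s≤s (∣p∪q∣≤∣p∣+∣q∣ p q)) (≤-reflexive (sym (+-suc _ _)))
∣p∪q∣≤∣p∣+∣q∣ (outside ∷ p) (outside ∷ q) = ∣p∪q∣≤∣p∣+∣q∣ p q

p⊆q∪r⇒∣p∣≤∣q∣+∣r∣ : ∀ {n} {p q r : Subset n} → p ⊆ q ∪ r → ∣ p ∣ ≤ ∣ q ∣ + ∣ r ∣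
p⊆q∪r⇒∣p∣≤∣q∣+∣r∣ {q = q} {r} p⊆q∪r = ≤-trans (p⊆q⇒∣p∣≤∣q∣ p⊆q∪r) (∣p∪q∣≤∣p∣+∣q∣ q r)

Empty⇒∣p∣≡0 : ∀ {n} {p : Subset n} → Empty p → ∣ p ∣ ≡ 0
Empty⇒∣p∣≡0 {n} p-empty = trans (cong ∣_∣ (Empty-unique p-empty)) (∣⊥∣≡0 n)

∣p∣>0⇒Nonempty : ∀ {n} {p : Subset n} → 0 < ∣ p ∣ → Nonempty p
∣p∣>0⇒Nonempty {p = p} 0<∣p∣ with nonempty? p
... | yes p-nonempty = p-nonempty
... | no p-empty = contradiction (Empty⇒∣p∣≡0 p-empty) (>⇒≢ 0<∣p∣)

Disjoint : ∀ {n} → Subset n → Subset n → Set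
Disjoint p q = ∀ {x} → x ∈ p → x ∉ q

drop-∷-Disjoint : ∀ {n s t} {p q : Subset n} → Disjoint (s ∷ p) (t ∷ q) → Disjoint p q
drop-∷-Disjoint disj x∈p x∈q = disj (there x∈p) (there x∈q)

∣p∪q∣≡∣p∣+∣q∣ : ∀ {n} {p q : Subset n} → Disjoint p q → ∣ p ∪ q ∣ ≡ ∣ p ∣ + ∣ q ∣
∣p∪q∣≡∣p∣+∣q∣ {p = []} {[]} _ = refl
∣p∪q∣≡∣p∣+∣q∣ {p = inside ∷ p} {inside ∷ q} disj = contradiction here (disj here)
∣p∪q∣≡∣p∣+∣q∣ {p = inside ∷ p} {outside ∷ q} disj = cong suc (∣p∪q∣≡∣p∣+∣q∣ (drop-∷-Disjoint disj))
∣p∪q∣≡∣p∣+∣q∣ {p = outside ∷ p} {inside ∷ q} disj =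
  trans (cong suc (∣p∪q∣≡∣p∣+∣q∣ (drop-∷-Disjoint disj))) (sym (+-suc _ _))
∣p∪q∣≡∣p∣+∣q∣ {p = outside ∷ p} {outside ∷ q} disj = ∣p∪q∣≡∣p∣+∣q∣ (drop-∷-Disjoint disj)

x∈p─q⇒x∉q : ∀ {n} {p q : Subset n} {x} → x ∈ p ─ q → x ∉ q
x∈p─q⇒x∉q {p = s ∷ p} {inside ∷ q} {zero} ()
x∈p─q⇒x∉q {p = s ∷ p} {outside ∷ q} {zero} _ ()
x∈p─q⇒x∉q {p = s ∷ p} {t ∷ q} {suc x} (there x∈) (there x∈q) = x∈p─q⇒x∉q x∈ x∈q

-- Hall's marriage theorem

record BipartiteGraph (a m : ℕ) : Set₁ where
  field
    Edge  : Fin a → Fin m → Set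
    edge? : ∀ x y → Dec (Edge x y)

open BipartiteGraph

module _ {a m : ℕ} where

  adjacent? : ∀ (G : BipartiteGraph a m) (T : Subset a) → Decidable λ y → ∃ λ x → x ∈ T × Edge G x y
  adjacent? G T y = any? λ x → x ∈? T ×-dec edge? G x y

  nbhd : BipartiteGraph a m → Subset a → Subset m
  nbhd G T = toSubset (adjacent? G T)

  ∈nbhd⁺ : ∀ G {T x y} → x ∈ T → Edge G x y → y ∈ nbhd G T
  ∈nbhd⁺ G {T} x∈T xy = ∈-toSubset⁺ (adjacent? G T) (_ , x∈T , xy)

  ∈nbhd⁻ : ∀ G {T y} → y ∈ nbhd G T → ∃ λ x → x ∈ T × Edge G x y
  ∈nbhd⁻ G {T} = ∈-toSubset⁻ (adjacent? G T)

  _∖_ : BipartiteGraph a m → Subset m → BipartiteGraph a m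
  G ∖ Y = record
    { Edge  = λ x y → Edge G x y × y ∉ Y
    ; edge? = λ x y → edge? G x y ×-dec ¬? (y ∈? Y)
    }

  nbhd-∖ : ∀ G Y {T} → nbhd G T ⊆ nbhd (G ∖ Y) T ∪ Y
  nbhd-∖ G Y {T} {y} y∈N with y ∈? Y | ∈nbhd⁻ G y∈N
  ... | yes y∈Y | _ = q⊆p∪q (nbhd (G ∖ Y) T) Y y∈Y
  ... | no y∉Y | x , x∈T , xy = p⊆p∪q {p = nbhd (G ∖ Y) T} Y (∈nbhd⁺ (G ∖ Y) {T} x∈T (xy , y∉Y))

  nbhd-∪ : ∀ G S T → nbhd G (S ∪ T) ⊆ nbhd (G ∖ nbhd G T) S ∪ nbhd G T
  nbhd-∪ G S T {y} y∈N with y ∈? nbhd G T | ∈nbhd⁻ G y∈N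
  ... | yes y∈NT | _ = q⊆p∪q (nbhd (G ∖ nbhd G T) S) (nbhd G T) y∈NT
  ... | no y∉NT | x , x∈S∪T , xy with x∈p∪q⁻ S T x∈S∪T
  ...   | inj₁ x∈S = p⊆p∪q {p = nbhd (G ∖ nbhd G T) S} (nbhd G T) (∈nbhd⁺ (G ∖ nbhd G T) {S} x∈S (xy , y∉NT))
  ...   | inj₂ x∈T = contradiction (∈nbhd⁺ G {T} x∈T xy) y∉NT

  HallCondition : BipartiteGraph a m → Subset a → Set
  HallCondition G L = ∀ T → T ⊆ L → ∣ T ∣ ≤ ∣ nbhd G T ∣

  record Matching (G : BipartiteGraph a m) (L : Subset a) : Set where
    field
      partner           : ∀ {x} → x ∈ L → Fin m
      partner-edge      : ∀ {x} (x∈L : x ∈ L) → Edge G x (partner x∈L)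
      partner-injective : ∀ {x y} (x∈L : x ∈ L) (y∈L : y ∈ L) → partner x∈L ≡ partner y∈L → x ≡ y

  open Matching

  emptyMatching : ∀ {G L} → Empty L → Matching G L
  emptyMatching L-empty = record
    { partner           = λ x∈L → contradiction (_ , x∈L) L-empty
    ; partner-edge      = λ x∈L → contradiction (_ , x∈L) L-empty
    ; partner-injective = λ x∈L _ _ → contradiction (_ , x∈L) L-empty
    }

  singletonMatching : ∀ {G x y} → Edge G x y → Matching G ⁅ x ⁆
  singletonMatching {G} {y = y} xy = record
    { partner           = λ _ → y
    ; partner-edge      = λ x′∈⁅x⁆ → subst (λ x′ → Edge G x′ y) (sym (x∈⁅y⁆⇒x≡y _ x′∈⁅x⁆)) xy
    ; partner-injective = λ x′∈⁅x⁆ x″∈⁅x⁆ _ → trans (x∈⁅y⁆⇒x≡y _ x′∈⁅x⁆) (sym (x∈⁅y⁆⇒x≡y _ x″∈⁅x⁆))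
    }

  joinMatchings : ∀ {G L T} Y → T ⊆ L → (M : Matching G T) → (∀ {x} (x∈T : x ∈ T) → partner M x∈T ∈ Y) →
                  Matching (G ∖ Y) (L ─ T) → Matching G L
  joinMatchings {G} {L} {T} Y T⊆L M M⊆Y M′ = record
    { partner           = λ {x} x∈L → choose x∈L (x ∈? T)
    ; partner-edge      = λ {x} x∈L → choose-edge x∈L (x ∈? T)
    ; partner-injective = λ {x} {x′} x∈L x′∈L → choose-injective x∈L x′∈L (x ∈? T) (x′ ∈? T)
    }
    where
    choose : ∀ {x} → x ∈ L → Dec (x ∈ T) → Fin m
    choose _ (yes x∈T) = partner M x∈T
    choose x∈L (no x∉T) = partner M′ (x∈p∧x∉q⇒x∈p─q x∈L x∉T)

    choose-edge : ∀ {x} (x∈L : x ∈ L) x∈T? → Edge G x (choose x∈L x∈T?)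
    choose-edge _ (yes x∈T) = partner-edge M x∈T
    choose-edge x∈L (no x∉T) = proj₁ (partner-edge M′ (x∈p∧x∉q⇒x∈p─q x∈L x∉T))

    separated : ∀ {x x′} (x∈T : x ∈ T) (x′∈L─T : x′ ∈ L ─ T) → partner M x∈T ≢ partner M′ x′∈L─T
    separated x∈T x′∈L─T eq = proj₂ (partner-edge M′ x′∈L─T) (subst (_∈ Y) eq (M⊆Y x∈T))

    choose-injective : ∀ {x x′} (x∈L : x ∈ L) (x′∈L : x′ ∈ L) x∈T? x′∈T? →
                       choose x∈L x∈T? ≡ choose x′∈L x′∈T? → x ≡ x′
    choose-injective _ _ (yes x∈T) (yes x′∈T) = partner-injective M x∈T x′∈T
    choose-injective _ _ (no x∉T) (no x′∉T) = partner-injective M′ _ _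
    choose-injective _ _ (yes x∈T) (no x′∉T) eq = contradiction eq (separated x∈T _)
    choose-injective _ _ (no x∉T) (yes x′∈T) eq = contradiction (sym eq) (separated x′∈T _)

  HallCondition-⊆ : ∀ {G L L′} → L′ ⊆ L → HallCondition G L → HallCondition G L′
  HallCondition-⊆ L′⊆L hc T T⊆L′ = hc T (L′⊆L ∘ T⊆L′)

  HallBelow : ℕ → Set₁
  HallBelow k = ∀ {G L} → ∣ L ∣ < k → HallCondition G L → Matching G L

  Critical : BipartiteGraph a m → Subset a → Subset a → Set
  Critical G L T = T ⊆ L × Nonempty T × ∣ T ∣ < ∣ L ∣ × ∣ nbhd G T ∣ ≤ ∣ T ∣

  critical? : ∀ G L → Decidable (Critical G L)
  critical? G L T = T ⊆? L ×-dec nonempty? T ×-dec ∣ T ∣ <? ∣ L ∣ ×-dec ∣ nbhd G T ∣ ≤? ∣ T ∣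

  -- A critical T is matched into its own neighbourhood, and the rest of L into the rest of the graph.
  matching-via-critical : ∀ {G L T} → HallBelow ∣ L ∣ → Critical G L T → HallCondition G L → Matching G L
  matching-via-critical {G} {L} {T} IH (T⊆L , (x , x∈T) , ∣T∣<∣L∣ , ∣NT∣≤∣T∣) hc =
    joinMatchings (nbhd G T) T⊆L M (λ x∈T → ∈nbhd⁺ G {T} x∈T (partner-edge M x∈T)) M′
    where
    M : Matching G T
    M = IH ∣T∣<∣L∣ (HallCondition-⊆ T⊆L hc)

    G′ = G ∖ nbhd G T

    rest-hall : HallCondition G′ (L ─ T)
    rest-hall S S⊆L─T = +-cancelʳ-≤ _ _ _ (begin
      ∣ S ∣ + ∣ T ∣              ≡⟨ ∣p∪q∣≡∣p∣+∣q∣ (x∈p─q⇒x∉q ∘ S⊆L─T) ⟨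
      ∣ S ∪ T ∣                  ≤⟨ hc (S ∪ T) S∪T⊆L ⟩
      ∣ nbhd G (S ∪ T) ∣         ≤⟨ p⊆q∪r⇒∣p∣≤∣q∣+∣r∣ (nbhd-∪ G S T) ⟩
      ∣ nbhd G′ S ∣ + ∣ nbhd G T ∣ ≤⟨ +-monoʳ-≤ ∣ nbhd G′ S ∣ ∣NT∣≤∣T∣ ⟩
      ∣ nbhd G′ S ∣ + ∣ T ∣        ∎)
      where
      open ≤-Reasoning
      S∪T⊆L : S ∪ T ⊆ L
      S∪T⊆L x∈S∪T with x∈p∪q⁻ S T x∈S∪T
      ... | inj₁ x∈S = p─q⊆p L T (S⊆L─T x∈S)
      ... | inj₂ x∈T = T⊆L x∈T

    M′ : Matching G′ (L ─ T)
    M′ = IH (p∩q≢∅⇒∣p─q∣<∣p∣ L T (x , x∈p∩q⁺ (T⊆L x∈T , x∈T))) rest-hall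

  -- Without critical sets, any edge x₀y₀ can be used: deleting x₀ and y₀ preserves Hall's condition.
  matching-via-edge : ∀ {G L x₀} → HallBelow ∣ L ∣ → x₀ ∈ L → (∀ T → ¬ Critical G L T) →
                      HallCondition G L → Matching G L
  matching-via-edge {G} {L} {x₀} IH x₀∈L no-critical hc =
    joinMatchings ⁅ y₀ ⁆ ⁅x₀⁆⊆L (singletonMatching x₀y₀) (λ _ → x∈⁅x⁆ y₀) M′
    where
    ⁅x₀⁆⊆L : ⁅ x₀ ⁆ ⊆ L
    ⁅x₀⁆⊆L x∈⁅x₀⁆ = subst (_∈ L) (sym (x∈⁅y⁆⇒x≡y x₀ x∈⁅x₀⁆)) x₀∈L

    x₀-has-neighbour : ∃ (Edge G x₀)
    x₀-has-neighbour with ∣p∣>0⇒Nonempty (≤-trans (≤-reflexive (sym (∣⁅x⁆∣≡1 x₀))) (hc ⁅ x₀ ⁆ ⁅x₀⁆⊆L))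
    ... | y , y∈N with ∈nbhd⁻ G {⁅ x₀ ⁆} y∈N
    ...   | x , x∈⁅x₀⁆ , xy = y , subst (λ x → Edge G x y) (x∈⁅y⁆⇒x≡y x₀ x∈⁅x₀⁆) xy

    y₀ : Fin m
    y₀ = proj₁ x₀-has-neighbour

    x₀y₀ : Edge G x₀ y₀
    x₀y₀ = proj₂ x₀-has-neighbour

    G′ = G ∖ ⁅ y₀ ⁆

    rest-hall : HallCondition G′ (L - x₀)
    rest-hall S S⊆L-x₀ with nonempty? S
    ... | no S-empty = ≤-trans (≤-reflexive (Empty⇒∣p∣≡0 S-empty)) z≤n
    ... | yes S-nonempty = s≤s⁻¹ (begin
      suc ∣ S ∣                ≤⟨ ≰⇒> (λ ∣NS∣≤∣S∣ → no-critical S (S⊆L , S-nonempty , ∣S∣<∣L∣ , ∣NS∣≤∣S∣)) ⟩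
      ∣ nbhd G S ∣             ≤⟨ p⊆q∪r⇒∣p∣≤∣q∣+∣r∣ (nbhd-∖ G ⁅ y₀ ⁆) ⟩
      ∣ nbhd G′ S ∣ + ∣ ⁅ y₀ ⁆ ∣ ≡⟨ cong (∣ nbhd G′ S ∣ +_) (∣⁅x⁆∣≡1 y₀) ⟩
      ∣ nbhd G′ S ∣ + 1          ≡⟨ +-comm ∣ nbhd G′ S ∣ 1 ⟩
      suc ∣ nbhd G′ S ∣          ∎)
      where
      open ≤-Reasoning
      S⊆L : S ⊆ L
      S⊆L = p─q⊆p L ⁅ x₀ ⁆ ∘ S⊆L-x₀
      ∣S∣<∣L∣ : ∣ S ∣ < ∣ L ∣
      ∣S∣<∣L∣ = ≤-<-trans (p⊆q⇒∣p∣≤∣q∣ S⊆L-x₀) (x∈p⇒∣p-x∣<∣p∣ x₀∈L)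

    M′ : Matching G′ (L - x₀)
    M′ = IH (x∈p⇒∣p-x∣<∣p∣ x₀∈L) rest-hall

  hall-step : ∀ {G L} → HallBelow ∣ L ∣ → HallCondition G L → Matching G L
  hall-step {G} {L} IH hc with nonempty? L | anySubset? (critical? G L)
  ... | no L-empty | _ = emptyMatching L-empty
  ... | yes _ | yes (T , T-critical) = matching-via-critical IH T-critical hc
  ... | yes (x₀ , x₀∈L) | no no-critical = matching-via-edge IH x₀∈L (λ T T-critical → no-critical (T , T-critical)) hc

  hallBelow : ∀ k → HallBelow k
  hallBelow zero ()
  hallBelow (suc k) ∣L∣<1+k = hall-step λ ∣L′∣<∣L∣ → hallBelow k (<-≤-trans ∣L′∣<∣L∣ (s≤s⁻¹ ∣L∣<1+k))

  hall : ∀ {G L} → HallCondition G L → Matching G L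
  hall {L = L} = hallBelow (suc ∣ L ∣) ≤-refl

  -- Double counting the edges leaving T: each x ∈ T has at least D of them,
  -- each vertex of nbhd G T receives at most D.
  hallCondition-from-degrees :
    ∀ G L D .{{_ : NonZero D}} → (∀ {x} → x ∈ L → D ≤ ∑[ y < m ] 𝟙 (edge? G x y)) →
    (∀ y → ∑[ x < a ] 𝟙 (x ∈? L ×-dec edge? G x y) ≤ D) → HallCondition G L
  hallCondition-from-degrees G L D left-degree right-degree T T⊆L = *-cancelˡ-≤ D (begin
    D * ∣ T ∣                                          ≡⟨ cong (D *_) (∣p∣≡∑𝟙 T) ⟩
    D * ∑[ x < a ] 𝟙 (x ∈? T)                          ≡⟨ *-distribˡ-sum D (λ x → 𝟙 (x ∈? T)) ⟩
    ∑[ x < a ] (D * 𝟙 (x ∈? T))                        ≤⟨ sum-mono-≤ from-left ⟩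
    ∑[ x < a ] ∑[ y < m ] 𝟙 (x ∈? T ×-dec edge? G x y) ≡⟨ ∑-comm (λ x y → 𝟙 (x ∈? T ×-dec edge? G x y)) ⟩
    ∑[ y < m ] ∑[ x < a ] 𝟙 (x ∈? T ×-dec edge? G x y) ≤⟨ sum-mono-≤ from-right ⟩
    ∑[ y < m ] (D * 𝟙 (adjacent? G T y))               ≡⟨ *-distribˡ-sum D (𝟙 ∘ adjacent? G T) ⟨
    D * ∑[ y < m ] 𝟙 (adjacent? G T y)                 ≡⟨ cong (D *_) (∣toSubset∣ (adjacent? G T)) ⟨
    D * ∣ nbhd G T ∣                                   ∎)
    where
    open ≤-Reasoning

    from-left : ∀ x → D * 𝟙 (x ∈? T) ≤ ∑[ y < m ] 𝟙 (x ∈? T ×-dec edge? G x y)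
    from-left x with x ∈? T
    ... | yes x∈T = ≤-trans (≤-reflexive (*-identityʳ D)) (left-degree (T⊆L x∈T))
    ... | no _ = ≤-trans (≤-reflexive (*-zeroʳ D)) z≤n

    from-right : ∀ y → ∑[ x < a ] 𝟙 (x ∈? T ×-dec edge? G x y) ≤ D * 𝟙 (adjacent? G T y)
    from-right y with adjacent? G T y
    ... | yes _ = begin
      ∑[ x < a ] 𝟙 (x ∈? T ×-dec edge? G x y)
        ≤⟨ sum-mono-≤ (λ x → 𝟙-mono (map₁ T⊆L) (x ∈? T ×-dec edge? G x y) (x ∈? L ×-dec edge? G x y)) ⟩
      ∑[ x < a ] 𝟙 (x ∈? L ×-dec edge? G x y) ≤⟨ right-degree y ⟩
      D                                       ≡⟨ *-identityʳ D ⟨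
      D * 1                                   ∎
    ... | no not-adjacent = begin
      ∑[ x < a ] 𝟙 (x ∈? T ×-dec edge? G x y)
        ≡⟨ sum-cong-≗ (λ x → 𝟙-no (x ∈? T ×-dec edge? G x y) (not-adjacent ∘ (x ,_))) ⟩
      ∑[ x < a ] 0                            ≡⟨ sum-replicate-zero a ⟩
      0                                       ≤⟨ z≤n ⟩
      D * 0                                   ∎

-- Counting subsets

0<nCk : ∀ {n k} → k ≤ n → 0 < n C k
0<nCk {n} {zero} _ = s≤s z≤n
0<nCk {suc n} {suc k} (s≤s k≤n) =
  ≤-trans (0<nCk k≤n) (≤-trans (m≤m+n (n C k) (n C suc k)) (≤-reflexive (nCk+nC[k+1]≡[n+1]C[k+1] n k)))

n≤nCk : ∀ {n k} → 1 ≤ k → k < n → n ≤ n C k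
n≤nCk {suc n} {1} _ _ = ≤-reflexive (sym (nC1≡n (suc n)))
n≤nCk {suc n} {suc (suc k)} _ (s≤s k+1<n) = begin
  suc n                         ≡⟨ +-comm 1 n ⟩
  n + 1                         ≤⟨ +-mono-≤ (n≤nCk (s≤s z≤n) k+1<n) (0<nCk k+1<n) ⟩
  n C suc k + n C suc (suc k)   ≡⟨ nCk+nC[k+1]≡[n+1]C[k+1] n (suc k) ⟩
  suc n C suc (suc k)           ∎
  where open ≤-Reasoning

side : Fin 2 → Side
side zero = outside
side (suc zero) = inside

side-injective : ∀ {b b′} → side b ≡ side b′ → b ≡ b′
side-injective {zero} {zero} _ = refl
side-injective {zero} {suc zero} ()
side-injective {suc zero} {zero} ()
side-injective {suc zero} {suc zero} _ = refl

subset : ∀ n → Fin (2 ^ n) → Subset n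
subset zero _ = []
subset (suc n) k = side (proj₁ (remQuot {2} (2 ^ n) k)) ∷ subset n (proj₂ (remQuot {2} (2 ^ n) k))

subset-injective : ∀ n {k l} → subset n k ≡ subset n l → k ≡ l
subset-injective zero {zero} {zero} _ = refl
subset-injective (suc n) {k} {l} eq with ∷-injective eq
... | head-eq , tail-eq = begin
  k                                   ≡⟨ combine-remQuot {2} (2 ^ n) k ⟨
  combine (proj₁ (remQuot {2} (2 ^ n) k)) (proj₂ (remQuot {2} (2 ^ n) k))
                                      ≡⟨ cong₂ combine (side-injective head-eq) (subset-injective n tail-eq) ⟩
  combine (proj₁ (remQuot {2} (2 ^ n) l)) (proj₂ (remQuot {2} (2 ^ n) l))
                                      ≡⟨ combine-remQuot {2} (2 ^ n) l ⟩
  l                                   ∎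
  where open ≡-Reasoning

#subsets : ∀ {n p} {P : Subset n → Set p} → Decidable P → ℕ
#subsets {n} P? = ∑[ k < 2 ^ n ] 𝟙 (P? (subset n k))

#subsets-∷ : ∀ {n p} {P : Subset (suc n) → Set p} (P? : Decidable P) →
             #subsets P? ≡ #subsets (P? ∘ (outside ∷_)) + #subsets (P? ∘ (inside ∷_))
#subsets-∷ {n} P? = trans (∑-remQuot 2 λ (b , k) → 𝟙 (P? (side b ∷ subset n k)))
  (cong (#subsets (P? ∘ (outside ∷_)) +_) (+-identityʳ _))

#subsets-mono : ∀ {n p q} {P : Subset n → Set p} {Q : Subset n → Set q} (P? : Decidable P) (Q? : Decidable Q) →
                (∀ {h} → P h → Q h) → #subsets P? ≤ #subsets Q?
#subsets-mono {n} P? Q? P⇒Q = sum-mono-≤ λ k → 𝟙-mono P⇒Q (P? (subset n k)) (Q? (subset n k))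

supersetOfSize? : ∀ {n} (U : Subset n) t → Decidable λ h → U ⊆ h × ∣ h ∣ ≡ t
supersetOfSize? U t h = U ⊆? h ×-dec ∣ h ∣ ≟ t

#subsets-outside≤ : ∀ {n p} {P : Subset (suc n) → Set p} (P? : Decidable P) →
                    #subsets (P? ∘ (outside ∷_)) ≤ #subsets P?
#subsets-outside≤ P? = ≤-trans (m≤m+n _ _) (≤-reflexive (sym (#subsets-∷ P?)))

#subsets-inside≤ : ∀ {n p} {P : Subset (suc n) → Set p} (P? : Decidable P) →
                   #subsets (P? ∘ (inside ∷_)) ≤ #subsets P?
#subsets-inside≤ P? = ≤-trans (m≤n+m _ _) (≤-reflexive (sym (#subsets-∷ P?)))

C≤#supersets : ∀ {n} (U : Subset n) s → (n ∸ ∣ U ∣) C s ≤ #subsets (supersetOfSize? U (∣ U ∣ + s))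
C≤#supersets [] zero = ≤-refl
C≤#supersets [] (suc s) = z≤n
C≤#supersets {suc n} (inside ∷ U) s = begin
  (n ∸ ∣ U ∣) C s                         ≤⟨ C≤#supersets U s ⟩
  #subsets (supersetOfSize? U (∣ U ∣ + s)) ≤⟨ #subsets-mono (supersetOfSize? U (∣ U ∣ + s)) (P? ∘ (inside ∷_))
                                                           (map in⊆in (cong suc)) ⟩
  #subsets (P? ∘ (inside ∷_))             ≤⟨ #subsets-inside≤ P? ⟩
  #subsets P?                             ∎
  where
  open ≤-Reasoning
  P? = supersetOfSize? (inside ∷ U) (suc ∣ U ∣ + s)
C≤#supersets {suc n} (outside ∷ U) zero = begin
  (n ∸ ∣ U ∣) C 0                         ≤⟨ C≤#supersets U 0 ⟩
  #subsets (supersetOfSize? U (∣ U ∣ + 0)) ≤⟨ #subsets-mono (supersetOfSize? U (∣ U ∣ + 0)) (P? ∘ (outside ∷_))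
                                                           (map₁ out⊆) ⟩
  #subsets (P? ∘ (outside ∷_))            ≤⟨ #subsets-outside≤ P? ⟩
  #subsets P?                             ∎
  where
  open ≤-Reasoning
  P? = supersetOfSize? (outside ∷ U) (∣ U ∣ + 0)
C≤#supersets {suc n} (outside ∷ U) (suc s) = begin
  (suc n ∸ ∣ U ∣) C suc s                 ≡⟨ cong (_C suc s) (+-∸-assoc 1 (∣p∣≤n U)) ⟩
  suc (n ∸ ∣ U ∣) C suc s                 ≡⟨ nCk+nC[k+1]≡[n+1]C[k+1] (n ∸ ∣ U ∣) s ⟨
  (n ∸ ∣ U ∣) C s + (n ∸ ∣ U ∣) C suc s  ≤⟨ +-mono-≤ (C≤#supersets U s) (C≤#supersets U (suc s)) ⟩
  #subsets (supersetOfSize? U (∣ U ∣ + s)) + #subsets (supersetOfSize? U (∣ U ∣ + suc s))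
    ≤⟨ +-mono-≤ (#subsets-mono (supersetOfSize? U (∣ U ∣ + s)) (P? ∘ (inside ∷_))
                               (map out⊆ λ ∣h∣≡ → trans (cong suc ∣h∣≡) (sym (+-suc ∣ U ∣ s))))
                (#subsets-mono (supersetOfSize? U (∣ U ∣ + suc s)) (P? ∘ (outside ∷_)) (map₁ out⊆)) ⟩
  #subsets (P? ∘ (inside ∷_)) + #subsets (P? ∘ (outside ∷_))
    ≡⟨ +-comm (#subsets (P? ∘ (inside ∷_))) _ ⟩
  #subsets (P? ∘ (outside ∷_)) + #subsets (P? ∘ (inside ∷_))
    ≡⟨ #subsets-∷ P? ⟨
  #subsets P?                             ∎
  where
  open ≤-Reasoning
  P? = supersetOfSize? (outside ∷ U) (∣ U ∣ + suc s)

#increasingPairs : ∀ {n} (h : Subset n) →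
                   ∑[ x < n ] ∑[ y < n ] 𝟙 (x Fin.<? y ×-dec x ∈? h ×-dec y ∈? h) ≡ ∣ h ∣ C 2
#increasingPairs [] = refl
#increasingPairs {suc n} (inside ∷ h) = begin
  ∑[ y < n ] 𝟙 (y ∈? h) + ∑[ x < n ] ∑[ y < n ] 𝟙 (x Fin.<? y ×-dec x ∈? h ×-dec y ∈? h)
                             ≡⟨ cong₂ _+_ (∣p∣≡∑𝟙 h) (sym (#increasingPairs h)) ⟨
  ∣ h ∣ + ∣ h ∣ C 2          ≡⟨ cong (_+ ∣ h ∣ C 2) (nC1≡n ∣ h ∣) ⟨
  ∣ h ∣ C 1 + ∣ h ∣ C 2      ≡⟨ nCk+nC[k+1]≡[n+1]C[k+1] ∣ h ∣ 1 ⟩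
  suc ∣ h ∣ C 2              ∎
  where open ≡-Reasoning
#increasingPairs {suc n} (outside ∷ h) = cong₂ _+_ (sum-replicate-zero n) (#increasingPairs h)

Covers : ∀ {n} → Subset n → Fin n × Fin n → Set
Covers h (x , y) = x ∈ h × y ∈ h

covers? : ∀ {n} (h : Subset n) → Decidable (Covers h)
covers? h (x , y) = x ∈? h ×-dec y ∈? h

increasing? : ∀ {n} → Decidable (λ (e : Fin n × Fin n) → proj₁ e Fin.< proj₂ e)
increasing? (x , y) = x Fin.<? y

endpointSet : ∀ {c n} → (Fin c → Fin n × Fin n) → Subset n
endpointSet {zero} e = ⊥
endpointSet {suc c} e = ⁅ proj₁ (e zero) ⁆ ∪ ⁅ proj₂ (e zero) ⁆ ∪ endpointSet (e ∘ suc)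

∣endpointSet∣≤2c : ∀ {c n} (e : Fin c → Fin n × Fin n) → ∣ endpointSet e ∣ ≤ 2 * c
∣endpointSet∣≤2c {zero} {n} e = ≤-reflexive (∣⊥∣≡0 n)
∣endpointSet∣≤2c {suc c} e = begin
  ∣ ⁅ x ⁆ ∪ ⁅ y ⁆ ∪ rest ∣        ≤⟨ ∣p∪q∣≤∣p∣+∣q∣ ⁅ x ⁆ (⁅ y ⁆ ∪ rest) ⟩
  ∣ ⁅ x ⁆ ∣ + ∣ ⁅ y ⁆ ∪ rest ∣    ≤⟨ +-monoʳ-≤ ∣ ⁅ x ⁆ ∣ (∣p∪q∣≤∣p∣+∣q∣ ⁅ y ⁆ rest) ⟩
  ∣ ⁅ x ⁆ ∣ + (∣ ⁅ y ⁆ ∣ + ∣ rest ∣) ≡⟨ cong₂ (λ a b → a + (b + ∣ rest ∣)) (∣⁅x⁆∣≡1 x) (∣⁅x⁆∣≡1 y) ⟩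
  2 + ∣ rest ∣                   ≤⟨ +-monoʳ-≤ 2 (∣endpointSet∣≤2c (e ∘ suc)) ⟩
  2 + 2 * c                      ≡⟨ *-suc 2 c ⟨
  2 * suc c                      ∎
  where
  open ≤-Reasoning
  x = proj₁ (e zero)
  y = proj₂ (e zero)
  rest = endpointSet (e ∘ suc)

endpointSet-covers : ∀ {c n} (e : Fin c → Fin n × Fin n) j → Covers (endpointSet e) (e j)
endpointSet-covers {suc c} e zero =
  p⊆p∪q (⁅ proj₂ (e zero) ⁆ ∪ endpointSet (e ∘ suc)) (x∈⁅x⁆ (proj₁ (e zero))) ,
  q⊆p∪q ⁅ proj₁ (e zero) ⁆ _ (p⊆p∪q (endpointSet (e ∘ suc)) (x∈⁅x⁆ (proj₂ (e zero))))
endpointSet-covers {suc c} e (suc j) = map lift lift (endpointSet-covers (e ∘ suc) j)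
  where
  lift : endpointSet (e ∘ suc) ⊆ endpointSet e
  lift = q⊆p∪q ⁅ proj₁ (e zero) ⁆ _ ∘ q⊆p∪q ⁅ proj₂ (e zero) ⁆ _

-- Colour classes of a colouring of the complete r-graph

module _ {c n : ℕ} (r : ℕ) (χ : Coloring c n) where

  -- Left vertices code the edges x < y of K_n as combine x y, right vertices code subsets of Fin n.
  pairs : Subset (n * n)
  pairs = toSubset (increasing? ∘ remQuot n)

  colourClass : Fin c → BipartiteGraph (n * n) (2 ^ n)
  colourClass j = record
    { Edge  = λ p k → Covers (subset n k) (remQuot n p) × ∣ subset n k ∣ ≡ r × χ (subset n k) ≡ j
    ; edge? = λ p k → covers? (subset n k) (remQuot n p) ×-dec ∣ subset n k ∣ ≟ r ×-dec χ (subset n k) Fin.≟ j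
    }

  degree : Fin c → Fin (n * n) → ℕ
  degree j p = ∑[ k < 2 ^ n ] 𝟙 (edge? (colourClass j) p k)

  pairs-per-hyperedge : ∀ j k → ∑[ p < n * n ] 𝟙 (p ∈? pairs ×-dec edge? (colourClass j) p k) ≤ r C 2
  pairs-per-hyperedge j k with ∣ subset n k ∣ ≟ r
  ... | yes ∣h∣≡r = begin
    ∑[ p < n * n ] 𝟙 (p ∈? pairs ×-dec edge? (colourClass j) p k)
      ≤⟨ sum-mono-≤ (λ p → 𝟙-mono (λ (p∈pairs , covers , _) → ∈-toSubset⁻ (increasing? ∘ remQuot n) p∈pairs , covers)
                                  (p ∈? pairs ×-dec edge? (colourClass j) p k) (g? (remQuot n p))) ⟩
    ∑[ p < n * n ] 𝟙 (g? (remQuot n p))               ≡⟨ ∑-remQuot n (𝟙 ∘ g?) ⟩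
    ∑[ x < n ] ∑[ y < n ] 𝟙 (g? (x , y))              ≡⟨ #increasingPairs h ⟩
    ∣ h ∣ C 2                                         ≡⟨ cong (_C 2) ∣h∣≡r ⟩
    r C 2                                             ∎
    where
    open ≤-Reasoning
    h = subset n k
    g? = λ e → increasing? e ×-dec covers? h e
  ... | no ∣h∣≢r = begin
    ∑[ p < n * n ] 𝟙 (p ∈? pairs ×-dec edge? (colourClass j) p k)
      ≡⟨ sum-cong-≗ (λ p → 𝟙-no (p ∈? pairs ×-dec edge? (colourClass j) p k) (∣h∣≢r ∘ proj₁ ∘ proj₂ ∘ proj₂)) ⟩
    ∑[ p < n * n ] 0                                  ≡⟨ sum-replicate-zero (n * n) ⟩
    0                                                 ≤⟨ z≤n ⟩
    r C 2                                             ∎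
    where open ≤-Reasoning

  bergeK-from-matching : ∀ {j} → Matching (colourClass j) pairs → HasBergeK r n χ j
  bergeK-from-matching {j} M = (λ x → x) , hyperedge , (λ eq → eq) , hyperedge-injective , properties
    where
    open Matching M

    code∈pairs : (e : EdgeK n) → combine (proj₁ (proj₁ e)) (proj₂ (proj₁ e)) ∈ pairs
    code∈pairs ((x , y) , x<y) =
      ∈-toSubset⁺ (increasing? ∘ remQuot n) (subst (λ e → proj₁ e Fin.< proj₂ e) (sym (remQuot-combine x y)) x<y)

    hyperedge : EdgeK n → Subset n
    hyperedge e = subset n (partner (code∈pairs e))

    hyperedge-injective : ∀ {e e′} → hyperedge e ≡ hyperedge e′ → proj₁ e ≡ proj₁ e′
    hyperedge-injective {(x , y) , _} {(x′ , y′) , _} eq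
      with combine-injective x y x′ y′ (partner-injective _ _ (subset-injective n eq))
    ... | refl , refl = refl

    properties : (e : EdgeK n) → ∣ hyperedge e ∣ ≡ r × χ (hyperedge e) ≡ j ×
                 proj₁ (proj₁ e) ∈ hyperedge e × proj₂ (proj₁ e) ∈ hyperedge e
    properties e@((x , y) , _) with partner-edge (code∈pairs e)
    ... | covers , size , colour with subst (Covers (hyperedge e)) (remQuot-combine x y) covers
    ...   | x∈h , y∈h = size , colour , x∈h , y∈h

  bergeK-in-dense-colour : ∀ {j} .{{_ : NonZero (r C 2)}} → (∀ {p} → p ∈ pairs → r C 2 ≤ degree j p) →
                           HasBergeK r n χ j
  bergeK-in-dense-colour {j} dense = bergeK-from-matching (hall
    (hallCondition-from-degrees (colourClass j) pairs (r C 2) dense (pairs-per-hyperedge j)))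

  -- Every r-superset of the endpoint set U of the sparse pairs lies in the colour class of its
  -- own colour, so it is counted by one of the c sparse degrees.
  sparse-pairs⇒n≤c+cD : ∀ {D} (P : Fin c → Fin (n * n)) → (∀ j → degree j (P j) < D) → 2 * c < r → r < n →
                        n ≤ c + c * D
  sparse-pairs⇒n≤c+cD {D} P sparse 2c<r r<n = begin
    n                                        ≤⟨ m≤n+m∸n n u ⟩
    u + (n ∸ u)                              ≤⟨ +-mono-≤ u≤2c (begin
      n ∸ u                                    ≤⟨ n≤nCk (m<n⇒0<n∸m u<r) (∸-monoˡ-< r<n (<⇒≤ u<r)) ⟩
      (n ∸ u) C (r ∸ u)                        ≤⟨ C≤#supersets U (r ∸ u) ⟩
      #subsets (supersetOfSize? U (u + (r ∸ u))) ≡⟨ cong (#subsets ∘ supersetOfSize? U) (m+[n∸m]≡n (<⇒≤ u<r)) ⟩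
      #subsets (supersetOfSize? U r)           ≤⟨ sum-mono-≤ counted ⟩
      ∑[ k < 2 ^ n ] ∑[ j < c ] 𝟙 (edge? (colourClass j) (P j) k) ≡⟨ ∑-comm (λ k j → 𝟙 (edge? (colourClass j) (P j) k)) ⟩
      ∑[ j < c ] degree j (P j)                ∎) ⟩
    2 * c + ∑[ j < c ] degree j (P j)        ≡⟨ cong (_+ ∑[ j < c ] degree j (P j)) (cong (c +_) (+-identityʳ c)) ⟩
    c + c + ∑[ j < c ] degree j (P j)        ≡⟨ +-assoc c c _ ⟩
    c + (c + ∑[ j < c ] degree j (P j))      ≡⟨ cong (c +_) (∑-suc (λ j → degree j (P j))) ⟨
    c + ∑[ j < c ] suc (degree j (P j))      ≤⟨ +-monoʳ-≤ c (sum-mono-≤ sparse) ⟩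
    c + ∑[ j < c ] D                         ≡⟨ cong (c +_) (∑-const c D) ⟩
    c + c * D                                ∎
    where
    open ≤-Reasoning
    U = endpointSet (remQuot n ∘ P)
    u = ∣ U ∣
    u≤2c = ∣endpointSet∣≤2c (remQuot n ∘ P)
    u<r = ≤-<-trans u≤2c 2c<r

    counted : ∀ k → 𝟙 (supersetOfSize? U r (subset n k)) ≤ ∑[ j < c ] 𝟙 (edge? (colourClass j) (P j) k)
    counted k = ≤-trans
      (𝟙-mono (λ (U⊆h , ∣h∣≡r) → map U⊆h U⊆h (endpointSet-covers (remQuot n ∘ P) j₀) , ∣h∣≡r , refl)
              (supersetOfSize? U r h) (edge? (colourClass j₀) (P j₀) k))
      (≤-sum (λ j → 𝟙 (edge? (colourClass j) (P j) k)) j₀)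
      where
      h = subset n k
      j₀ = χ h

  dense-or-sparse : ∀ D → (∃ λ j → ∀ {p} → p ∈ pairs → D ≤ degree j p) ⊎
                          (∃ λ (P : Fin c → Fin (n * n)) → ∀ j → degree j (P j) < D)
  dense-or-sparse D with any? (λ j → all? (λ p → p ∈? pairs →-dec D ≤? degree j p))
  ... | yes (j , dense) = inj₁ (j , λ {p} → dense p)
  ... | no no-dense = inj₂ ((λ j → proj₁ (sparse j)) , (λ j → proj₂ (sparse j)))
    where
    sparse : ∀ j → ∃ λ p → degree j p < D
    sparse j with ¬∀⟶∃¬ (n * n) _ (λ p → p ∈? pairs →-dec D ≤? degree j p) (λ dense → no-dense (j , dense))
    ... | p , not-dense = p , ≰⇒> (λ D≤ → not-dense (λ _ → D≤))

¬Arrows-below : ∀ {c r n N} → 0 < c → N < n → ¬ Arrows c r n N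
¬Arrows-below {suc c} _ N<n arrows with arrows (λ _ → zero)
... | _ , φ , _ , φ-injective , _ = <⇒≱ N<n (injective⇒≤ φ-injective)

proposition1 : (c r n : ℕ) → 1 ≤ c → 2 * c < r → c + c * (r C 2) < n →
    RamseyBergeK≡ c r n n
proposition1 c r n 1≤c 2c<r c+c[rC2]<n = arrows , λ N N<n → ¬Arrows-below 1≤c N<n
  where
  r≤rC2 : r ≤ r C 2
  r≤rC2 = n≤nCk (s≤s z≤n) (≤-<-trans (*-monoʳ-≤ 2 1≤c) 2c<r)

  instance
    rC2≢0 : NonZero (r C 2)
    rC2≢0 = >-nonZero (≤-trans (≤-<-trans z≤n 2c<r) r≤rC2)

  r<n : r < n
  r<n = ≤-<-trans (≤-trans r≤rC2 (≤-trans (m≤n*m (r C 2) c {{>-nonZero 1≤c}}) (m≤n+m _ c))) c+c[rC2]<n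

  arrows : Arrows c r n n
  arrows χ with dense-or-sparse r χ (r C 2)
  ... | inj₁ (j , dense) = j , bergeK-in-dense-colour r χ dense
  ... | inj₂ (P , sparse) = contradiction (sparse-pairs⇒n≤c+cD r χ P sparse 2c<r r<n) (<⇒≱ c+c[rC2]<n)
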